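{- Let $q\geq 2$ and let $C$ be a completely regular code in $H(3,q)$ with covering radius $1$ such that $C=C^1\cup C^2\cup C^3$, where for each $i\in\{1,2,3\}$, $C^i$ is a nonempty union of maximum cliques of codirection $i$, and $C^1,C^2,C^3$ are pairwise disjoint. Let $S,T,R\subseteq\mathcal{A}$ be minimal (by inclusion) such that $C^1\subseteq\mathcal{A}\times S\times T$ and $C^2\subseteq R\times\mathcal{A}\times T'$ for some $T'$, and write $\overline X=\mathcal{A}\setminus X$ (so that, by the structure of $C$, $C^2\subseteq R\times\mathcal{A}\times\overline T$ and $C^3\subseteq\overline R\times\overline S\times\mathcal{A}$). Let $D^1=\{(x_2,x_3):x\in C^1\}\subseteq S\times T$, $D^2=\{(x_1,x_3):x\in C^2\}\subseteq R\times\overline T$, $D^3=\{(x_1,x_2):x\in C^3\}\subseteq\overline R\times\overline S$, and let $\Gamma^1,\Gamma^2,\Gamma^3$ be the subgraphs of $H(2,q)$ induced by $S\times T$, $R\times\overline T$, $\overline R\times\overline S$ respectively. Then: (1) for each $i$, either $D^i$ equals the whole vertex set of $\Gamma^i$, or $D^i$ is a completely regular code in $\Gamma^i$ with covering radius $1$ and eigenvalue $-2$; (2) there are nonzero integers $a,b,c$ such that $|D^1\cap(S\times\{v\})|=a$ for all $v\in T$, $|D^1\cap(\{u\}\times T)|=b$ for all $u\in S$; $|D^2\cap(R\times\{v\})|=a$ for all $v\in\overline T$, $|D^2\cap(\{u\}\times\overline T)|=c$ for all $u\in R$; $|D^3\cap(\overline R\times\{v\})|=b$ for all $v\in\overline S$,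 $|D^3\cap(\{u\}\times\overline S)|=c$ for all $u\in\overline R$.
   Context: Let $\mathcal{A}$ be a set of size $q$; $H(n,q)$ has vertex set $\mathcal{A}^n$, tuples adjacent iff they differ in exactly one position. The subgraph of $H(2,q)$ induced on $X\times Y$ is the Cartesian product of complete graphs $K_{|X|}\square K_{|Y|}$, which is $(|X|+|Y|-2)$-regular. For a $k$-regular graph, a set $C$ of vertices is a completely regular code with covering radius $1$ if $C$ is a nonempty proper subset and there are integers $\beta,\gamma\geq1$ such that every vertex of $C$ has exactly $\beta$ neighbours outside $C$ and every vertex outside $C$ has exactly $\gamma$ neighbours in $C$; its eigenvalues are $k$ and $k-(\beta+\gamma)$, and "eigenvalue $-2$" means $k-(\beta+\gamma)=-2$. A maximum clique of codirection $i\in\{1,2,3\}$ in $H(3,q)$ is a set of $q$ tuples agreeing in all positions except position $i$ and taking all $q$ symbols in position $i$. -}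

module Defs where

open import Data.Nat using (ℕ; zero; suc; _+_; _≤_)
open import Data.Nat.Properties using () renaming (_≟_ to _≟ℕ_)
open import Data.Bool using (Bool; true; false; _∧_; _∨_; not; if_then_else_)
open import Data.Fin using (Fin; zero; suc)
open import Data.Fin.Properties using () renaming (_≟_ to _≟F_)
open import Data.Vec.Functional using (Vector; []; _∷_)
open import Data.Integer using (ℤ; +_; _-_)
open import Data.Product using (Σ; _×_; _,_; ∃; ∃₂)
open import Relation.Nullary using (does; ¬_)
open import Relation.Binary.PropositionalEquality using (_≡_)

[_] : Bool → ℕ
[ b ] = if b then 1 else 0

∑ : ∀ {q} → (Fin q → ℕ) → ℕ
∑ {zero}  f = 0
∑ {suc q} f = f zero + ∑ (λ i → f (suc i))

anyF : ∀ {q} → (Fin q → Bool) → Bool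
anyF {zero}  f = false
anyF {suc q} f = f zero ∨ anyF (λ i → f (suc i))

-- words of length n over the alphabet 𝒜 = Fin q : vertices of H(n,q)
Word : ℕ → ℕ → Set
Word n q = Vector (Fin q) n

∑W : ∀ {n q} → (Word n q → ℕ) → ℕ
∑W {zero}  f = f []
∑W {suc n} f = ∑ (λ a → ∑W (λ w → f (a ∷ w)))

SubA : ℕ → Set
SubA q = Fin q → Bool

card : ∀ {q} → SubA q → ℕ
card X = ∑ (λ a → [ X a ])

dist : ∀ {n q} → Word n q → Word n q → ℕ
dist {n} x y = ∑ {n} (λ i → [ not (does (x i ≟F y i)) ])

adj : ∀ {n q} → Word n q → Word n q → Bool
adj x y = does (dist x y ≟ℕ 1)

-- A graph = subgraph of H(n,q) induced on the vertex set {x | V x ≡ true}.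
-- Number of neighbours of x inside / outside C, within the induced subgraph.
nOut : ∀ {n q} → (V C : Word n q → Bool) → Word n q → ℕ
nOut V C x = ∑W (λ y → [ adj x y ∧ V y ∧ not (C y) ])

nIn : ∀ {n q} → (V C : Word n q → Bool) → Word n q → ℕ
nIn V C x = ∑W (λ y → [ adj x y ∧ V y ∧ C y ])

IsCRC1With : ∀ {n q} → (V C : Word n q → Bool) → ℕ → ℕ → Set
IsCRC1With V C β γ =
  (∀ x → C x ≡ true → V x ≡ true) ×
  (∃ λ x → C x ≡ true) ×
  (∃ λ x → V x ≡ true × C x ≡ false) ×
  (1 ≤ β) × (1 ≤ γ) ×
  (∀ x → V x ≡ true → C x ≡ true → nOut V C x ≡ β) ×
  (∀ x → V x ≡ true → C x ≡ false → nIn V C x ≡ γ)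

IsCRC1 : ∀ {n q} → (V C : Word n q → Bool) → Set
IsCRC1 V C = ∃₂ λ β γ → IsCRC1With V C β γ

-- CRC with covering radius 1 in a k-regular graph with eigenvalue θ = k - (β+γ)
IsCRC1Eigen : ∀ {n q} → (V C : Word n q → Bool) → (k : ℤ) → (θ : ℤ) → Set
IsCRC1Eigen V C k θ = ∃₂ λ β γ → IsCRC1With V C β γ × (k - + (β + γ) ≡ θ)

p₁ p₂ p₃ : Fin 3
p₁ = zero
p₂ = suc zero
p₃ = suc (suc zero)

-- x lies in the maximum clique of codirection i through c
-- (the q words agreeing with c outside position i)
InClique : ∀ {q} → Fin 3 → Word 3 q → Word 3 q → Set
InClique i c x = ∀ j → ¬ (j ≡ i) → x j ≡ c j

NonemptyUnionOfCliques : ∀ {q} → Fin 3 → (Word 3 q → Bool) → Set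
NonemptyUnionOfCliques {q} i D =
  (∃ λ x → D x ≡ true) ×
  (∃ λ (F : Word 3 q → Bool) →
     ∀ x → (D x ≡ true → ∃ λ c → F c ≡ true × InClique i c x)
         × ((∃ λ c → F c ≡ true × InClique i c x) → D x ≡ true))

w2 : ∀ {q} → Fin q → Fin q → Word 2 q
w2 u v = u ∷ v ∷ []

w3 : ∀ {q} → Fin q → Fin q → Fin q → Word 3 q
w3 a b c = a ∷ b ∷ c ∷ []

_⊆A_ : ∀ {q} → SubA q → SubA q → Set
X ⊆A Y = ∀ a → X a ≡ true → Y a ≡ true

∁ : ∀ {q} → SubA q → SubA q
∁ X a = not (X a)

⊆Box : ∀ {q} → (Word 3 q → Bool) → SubA q → SubA q → SubA q → Set
⊆Box D X Y Z = ∀ x → D x ≡ true → X (x p₁) ≡ true × Y (x p₂) ≡ true × Z (x p₃) ≡ true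

full : ∀ {q} → SubA q
full _ = true

box2 : ∀ {q} → SubA q → SubA q → Word 2 q → Bool
box2 X Y w = X (w zero) ∧ Y (w (suc zero))

-- Each Cⁱ is the cylinder over its projection Dⁱ, and two projections never meet on a common line,
-- since such a point would lie in two of the Cⁱ.  So along the lines through a point x of C¹ in directions
-- 2 and 3, the code consists of D¹ together with the cliques of C³, resp. C², crossing that line, and the
-- outer degree β of x is (q − |column of D¹|) + (q − |row of D¹|) minus the number of cliques of C² ∪ C³ in
-- the plane x₁ = const through x.  Hence that number does not depend on the plane, and likewise in the other
-- two directions.  Minimality of S, T, R makes every projection surjective onto its box sides, so each such
-- plane meets only one of the two families; this gives the constant row and column sizes a, b, c.  Finally,
-- a nonempty set of vertices of K_m □ K_n with constant row and column sizes is either everything or a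
-- completely regular code with covering radius 1 and β + γ = m + n, i.e. with eigenvalue −2.

module Submission where

open import Defs
open import Data.Bool using (Bool; true; false; _∧_; _∨_; not)
open import Data.Bool.Properties
  using (∨-comm; ∨-identityʳ; ∨-zeroʳ; ∨-idem; ∧-identityʳ; ∧-zeroʳ; ∧-comm)
open import Data.Empty using (⊥-elim)
open import Data.Fin using (Fin; zero; suc)
open import Data.Fin.Properties using (_≟_)
open import Data.Integer using (+_; -_; _-_)
open import Data.Integer.Properties using (+-0-abelianGroup)
open import Algebra.Properties.AbelianGroup +-0-abelianGroup using (xyx⁻¹≈y)
open import Data.Nat using (ℕ; zero; suc; _+_; _*_; _≤_; _<_; z≤n; s≤s)
open import Data.Nat.Properties
  using (+-identityʳ; +-cancelˡ-≡; +-cancelʳ-≡; +-commutativeSemigroup; m≤m+n; m≤n+m; ≤-trans; n>0⇒n≢0)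
  renaming (_≟_ to _≟ℕ_)
open import Algebra.Properties.CommutativeSemigroup +-commutativeSemigroup using (interchange)
open import Data.Product using (_×_; _,_; ∃; proj₁; proj₂)
open import Data.Sum using (_⊎_; inj₁; inj₂)
open import Data.Vec.Functional using ([]; _∷_; tail)
open import Function using (_∘_; id)
open import Relation.Nullary using (does; yes; no)
open import Relation.Binary.PropositionalEquality hiding ([_])

∧-true : ∀ {a b} → a ∧ b ≡ true → a ≡ true × b ≡ true
∧-true {true} b≡true = refl , b≡true

not-true : ∀ {x} → not x ≡ true → x ≡ false
not-true {false} _ = refl

contraposition : ∀ {x y} → (x ≡ true → y ≡ true) → y ≡ false → x ≡ false
contraposition {false} _   _  = refl
contraposition {true}  x⇒y ¬y with trans (sym (x⇒y refl)) ¬y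
... | ()

exclusive : ∀ {x y} → x ∧ y ≡ false → x ≡ true → y ≡ false
exclusive x∧y≡false refl = x∧y≡false

exclusive-sym : ∀ {x y} → (x ≡ true → y ≡ false) → y ≡ true → x ≡ false
exclusive-sym {false} _   _ = refl
exclusive-sym {true}  x⇒¬y y with trans (sym y) (x⇒¬y refl)
... | ()

∑-cong : ∀ {q} {f g : Fin q → ℕ} → f ≗ g → ∑ f ≡ ∑ g
∑-cong {zero}  f≗g = refl
∑-cong {suc q} f≗g = cong₂ _+_ (f≗g zero) (∑-cong (f≗g ∘ suc))

∑-+ : ∀ {q} (f g : Fin q → ℕ) → ∑ (λ i → f i + g i) ≡ ∑ f + ∑ g
∑-+ {zero}  f g = refl
∑-+ {suc q} f g = begin
  f zero + g zero + ∑ (λ i → f (suc i) + g (suc i))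
    ≡⟨ cong₂ _+_ refl (∑-+ (f ∘ suc) (g ∘ suc)) ⟩
  f zero + g zero + (∑ (f ∘ suc) + ∑ (g ∘ suc))
    ≡⟨ interchange (f zero) (g zero) _ _ ⟩
  f zero + ∑ (f ∘ suc) + (g zero + ∑ (g ∘ suc)) ∎
  where open ≡-Reasoning

∑-0 : ∀ {q} → ∑ {q} (λ _ → 0) ≡ 0
∑-0 {zero}  = refl
∑-0 {suc q} = ∑-0 {q}

∑-pick : ∀ {q} (u : Fin q) (f : Fin q → ℕ) → ∑ (λ a → [ does (u ≟ a) ] * f a) ≡ f u
∑-pick {suc q} zero    f = trans (cong₂ _+_ (+-identityʳ (f zero)) (∑-0 {q})) (+-identityʳ (f zero))
∑-pick {suc q} (suc u) f = ∑-pick u (f ∘ suc)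

card-cong : ∀ {q} {P Q : SubA q} → P ≗ Q → card P ≡ card Q
card-cong P≗Q = ∑-cong (cong [_] ∘ P≗Q)

card-≡0 : ∀ {q} {P : SubA q} → (∀ a → P a ≡ false) → card P ≡ 0
card-≡0 {q} P≡false = trans (card-cong P≡false) (∑-0 {q})

card-pos : ∀ {q} (P : SubA q) {a} → P a ≡ true → 0 < card P
card-pos P {zero}  Pa rewrite Pa = s≤s z≤n
card-pos P {suc a} Pa = ≤-trans (card-pos (P ∘ suc) Pa) (m≤n+m _ [ P zero ])

card≢0 : ∀ {q} (P : SubA q) {n a} → card P ≡ n → P a ≡ true → n ≢ 0
card≢0 P card≡n Pa = n>0⇒n≢0 (subst (0 <_) card≡n (card-pos P Pa))

card-∨ : ∀ {q} (P Q : SubA q) → (∀ a → P a ∧ Q a ≡ false) →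
  card (λ a → P a ∨ Q a) ≡ card P + card Q
card-∨ P Q disjoint = trans (∑-cong pointwise) (∑-+ (λ a → [ P a ]) (λ a → [ Q a ]))
  where
  pointwise : ∀ a → [ P a ∨ Q a ] ≡ [ P a ] + [ Q a ]
  pointwise a with P a | Q a | disjoint a
  ... | true  | false | _ = refl
  ... | false | _     | _ = refl

card-split : ∀ {q} (P Q : SubA q) → card (λ a → P a ∧ not (Q a)) + card (λ a → Q a ∧ P a) ≡ card P
card-split P Q = trans (sym (card-∨ _ _ disjoint)) (card-cong pointwise)
  where
  disjoint : ∀ a → (P a ∧ not (Q a)) ∧ (Q a ∧ P a) ≡ false
  disjoint a with P a | Q a
  ... | true  | true  = refl
  ... | true  | false = refl
  ... | false | _     = refl
  pointwise : ∀ a → (P a ∧ not (Q a)) ∨ (Q a ∧ P a) ≡ P a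
  pointwise a with P a | Q a
  ... | true  | true  = refl
  ... | true  | false = refl
  ... | false | true  = refl
  ... | false | false = refl

card-restrict : ∀ {q} (P Q : SubA q) → (∀ a → P a ≡ true → Q a ≡ true) → card (λ a → P a ∧ Q a) ≡ card P
card-restrict P Q P⊆Q = card-cong pointwise
  where
  pointwise : ∀ a → P a ∧ Q a ≡ P a
  pointwise a with P a in Pa
  ... | true  = P⊆Q a Pa
  ... | false = refl

card-except : ∀ {q} (u : Fin q) {P : SubA q} → P u ≡ false →
  card (λ a → not (does (u ≟ a)) ∧ P a) ≡ card P
card-except u {P} Pu = card-cong pointwise
  where
  pointwise : ∀ a → not (does (u ≟ a)) ∧ P a ≡ P a
  pointwise a with u ≟ a
  ... | yes refl = sym Pu
  ... | no  _    = refl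

line-inside : ∀ {q} (b : Fin q) (U : SubA q) → (∀ y → U y ≡ true) →
  card (λ y → not (does (b ≟ y)) ∧ not (U y)) ≡ 0
line-inside b U U≡true =
  card-≡0 λ y → trans (cong (λ t → not (does (b ≟ y)) ∧ not t) (U≡true y)) (∧-zeroʳ _)

card-line : ∀ {q} (b : Fin q) (U own other : SubA q) →
  (∀ y → U y ≡ own y ∨ other y) → own b ≡ true → (∀ y → other y ≡ true → own y ≡ false) →
  card (λ y → not (does (b ≟ y)) ∧ not (U y)) + card other ≡ card (λ y → not (own y))
card-line b U own other U≡ own-b other⇒¬own =
  trans (sym (card-∨ _ other disjoint)) (card-cong pointwise)
  where
  on-b : ∀ y → does (b ≟ y) ≡ true → own y ≡ true
  on-b y with b ≟ y
  ... | yes refl = λ _ → own-b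
  excluded : ∀ e o t → (e ∧ not (o ∨ t)) ∧ t ≡ false
  excluded false _     _     = refl
  excluded true  true  _     = refl
  excluded true  false true  = refl
  excluded true  false false = refl
  complement : ∀ e o t → (e ≡ true → o ≡ true) → (t ≡ true → o ≡ false) →
    (not e ∧ not (o ∨ t)) ∨ t ≡ not o
  complement true  false _     e⇒o _ with e⇒o refl
  ... | ()
  complement _     true  true  _ t⇒¬o with t⇒¬o refl
  ... | ()
  complement true  true  false _ _ = refl
  complement false true  false _ _ = refl
  complement false false false _ _ = refl
  complement false false true  _ _ = refl
  disjoint : ∀ y → (not (does (b ≟ y)) ∧ not (U y)) ∧ other y ≡ false
  disjoint y rewrite U≡ y = excluded (not (does (b ≟ y))) (own y) (other y)
  pointwise : ∀ y → (not (does (b ≟ y)) ∧ not (U y)) ∨ other y ≡ not (own y)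
  pointwise y rewrite U≡ y = complement (does (b ≟ y)) (own y) (other y) (on-b y) (other⇒¬own y)

anyF-intro : ∀ {q} (f : Fin q → Bool) {i} → f i ≡ true → anyF f ≡ true
anyF-intro f {zero}  fi rewrite fi = refl
anyF-intro f {suc i} fi rewrite anyF-intro (f ∘ suc) fi = ∨-zeroʳ (f zero)

anyF-elim : ∀ {q} (f : Fin q → Bool) → anyF f ≡ true → ∃ λ i → f i ≡ true
anyF-elim {suc q} f any-f with f zero in f0
... | true  = zero , f0
... | false = let i , fi = anyF-elim (f ∘ suc) any-f in suc i , fi

anyF-const : ∀ {q} (f : Fin (suc q) → Bool) {b} → (∀ i → f i ≡ b) → anyF f ≡ b
anyF-const {zero}  f {b} f≡b rewrite f≡b zero = ∨-identityʳ b
anyF-const {suc q} f {b} f≡b rewrite f≡b zero | anyF-const (f ∘ suc) (f≡b ∘ suc) = ∨-idem b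

-- Words are functions on Fin n, so a predicate on words need not respect pointwise equality
-- (there is no function extensionality); the predicates counted below all do.
Extensional : ∀ {n q} → (Word n q → Bool) → Set
Extensional G = ∀ {x y} → x ≗ y → G x ≡ G y

extensional-∷ : ∀ {n q} {G : Word (suc n) q → Bool} → Extensional G → ∀ a → Extensional (λ w → G (a ∷ w))
extensional-∷ ext a x≗y = ext λ { zero → refl ; (suc i) → x≗y i }

coordinates₂-extensional : ∀ {q} (g : Fin q → Fin q → Bool) → Extensional {2} (λ y → g (y zero) (y (suc zero)))
coordinates₂-extensional g x≗y = cong₂ g (x≗y zero) (x≗y (suc zero))

∑W-0 : ∀ {n q} → ∑W {n} {q} (λ _ → 0) ≡ 0
∑W-0 {zero}      = refl
∑W-0 {suc n} {q} = trans (∑-cong {q} (λ _ → ∑W-0 {n} {q})) (∑-0 {q})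

∑W-dist≡0 : ∀ {n q} (x : Word n q) (G : Word n q → Bool) → Extensional G →
  ∑W (λ y → [ does (dist x y ≟ℕ 0) ∧ G y ]) ≡ [ G x ]
∑W-dist≡0 {zero}      x G ext = cong [_] (ext (λ ()))
∑W-dist≡0 {suc n} {q} x G ext = begin
  ∑ (λ a → ∑W (λ w → [ does ([ not (does (x zero ≟ a)) ] + dist (tail x) w ≟ℕ 0) ∧ G (a ∷ w) ]))
    ≡⟨ ∑-cong (λ a → at-head (does (x zero ≟ a)) a) ⟩
  ∑ (λ a → [ does (x zero ≟ a) ] * ∑W (λ w → [ does (dist (tail x) w ≟ℕ 0) ∧ G (a ∷ w) ]))
    ≡⟨ ∑-pick (x zero) _ ⟩
  ∑W (λ w → [ does (dist (tail x) w ≟ℕ 0) ∧ G (x zero ∷ w) ])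
    ≡⟨ ∑W-dist≡0 (tail x) _ (extensional-∷ ext (x zero)) ⟩
  [ G (x zero ∷ tail x) ]
    ≡⟨ cong [_] (ext λ { zero → refl ; (suc i) → refl }) ⟩
  [ G x ] ∎
  where
  open ≡-Reasoning
  at-head : ∀ b a → ∑W (λ w → [ does ([ not b ] + dist (tail x) w ≟ℕ 0) ∧ G (a ∷ w) ])
                  ≡ [ b ] * ∑W (λ w → [ does (dist (tail x) w ≟ℕ 0) ∧ G (a ∷ w) ])
  at-head false a = ∑W-0 {n} {q}
  at-head true  a = sym (+-identityʳ _)

∑W-adj-split : ∀ {n q} (x : Word (suc n) q) (G : Word (suc n) q → Bool) → Extensional G →
  ∑W (λ y → [ adj x y ∧ G y ])
  ≡ card (λ a → not (does (x zero ≟ a)) ∧ G (a ∷ tail x)) + ∑W (λ w → [ adj (tail x) w ∧ G (x zero ∷ w) ])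
∑W-adj-split {n} {q} x G ext = begin
  ∑ (λ a → ∑W (λ w → [ adj x (a ∷ w) ∧ G (a ∷ w) ]))
    ≡⟨ ∑-cong (λ a → at-head (does (x zero ≟ a)) a) ⟩
  ∑ (λ a → [ not (does (x zero ≟ a)) ∧ G (a ∷ tail x) ] + [ does (x zero ≟ a) ] * adjacent-tail a)
    ≡⟨ ∑-+ (λ a → [ not (does (x zero ≟ a)) ∧ G (a ∷ tail x) ]) _ ⟩
  card first-coordinate + ∑ (λ a → [ does (x zero ≟ a) ] * adjacent-tail a)
    ≡⟨ cong (_+_ (card first-coordinate)) (∑-pick (x zero) adjacent-tail) ⟩
  card first-coordinate + adjacent-tail (x zero) ∎
  where
  open ≡-Reasoning
  first-coordinate : SubA q
  first-coordinate a = not (does (x zero ≟ a)) ∧ G (a ∷ tail x)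
  adjacent-tail : Fin q → ℕ
  adjacent-tail a = ∑W (λ w → [ adj (tail x) w ∧ G (a ∷ w) ])
  at-head : ∀ b a → ∑W (λ w → [ does ([ not b ] + dist (tail x) w ≟ℕ 1) ∧ G (a ∷ w) ])
                  ≡ [ not b ∧ G (a ∷ tail x) ] + [ b ] * adjacent-tail a
  at-head false a = trans (∑W-dist≡0 (tail x) _ (extensional-∷ ext a)) (sym (+-identityʳ _))
  at-head true  a = sym (+-identityʳ _)

adj-count₂ : ∀ {q} (x : Word 2 q) (G : Word 2 q → Bool) → Extensional G →
  ∑W (λ y → [ adj x y ∧ G y ])
  ≡ card (λ u → not (does (x zero ≟ u)) ∧ G (w2 u (x (suc zero))))
    + card (λ v → not (does (x (suc zero) ≟ v)) ∧ G (w2 (x zero) v))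
adj-count₂ x G ext = begin
  ∑W (λ y → [ adj x y ∧ G y ])
    ≡⟨ ∑W-adj-split x G ext ⟩
  card (λ u → not (does (x zero ≟ u)) ∧ G (u ∷ tail x)) + ∑W (λ w → [ adj (tail x) w ∧ G (x zero ∷ w) ])
    ≡⟨ cong₂ _+_ (card-cong λ u → cong (not (does (x zero ≟ u)) ∧_) (ext (row u)))
                 (∑W-adj-split (tail x) _ (extensional-∷ ext (x zero))) ⟩
  card (λ u → not (does (x zero ≟ u)) ∧ G (w2 u (x (suc zero))))
    + (card (λ v → not (does (x (suc zero) ≟ v)) ∧ G (x zero ∷ v ∷ tail (tail x))) + 0)
    ≡⟨ cong₂ _+_ refl (trans (+-identityʳ _)
                             (card-cong λ v → cong (not (does (x (suc zero) ≟ v)) ∧_) (ext (column v)))) ⟩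
  card (λ u → not (does (x zero ≟ u)) ∧ G (w2 u (x (suc zero))))
    + card (λ v → not (does (x (suc zero) ≟ v)) ∧ G (w2 (x zero) v)) ∎
  where
  open ≡-Reasoning
  row : ∀ u → (u ∷ tail x) ≗ w2 u (x (suc zero))
  row u = λ { zero → refl ; (suc zero) → refl }
  column : ∀ v → (x zero ∷ v ∷ tail (tail x)) ≗ w2 (x zero) v
  column v = λ { zero → refl ; (suc zero) → refl }

adj-count₃ : ∀ {q} (a b c : Fin q) (G : Word 3 q → Bool) → Extensional G →
  ∑W (λ y → [ adj (w3 a b c) y ∧ G y ])
  ≡ card (λ a′ → not (does (a ≟ a′)) ∧ G (w3 a′ b c))
    + (card (λ b′ → not (does (b ≟ b′)) ∧ G (w3 a b′ c))
    + card (λ c′ → not (does (c ≟ c′)) ∧ G (w3 a b c′)))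
adj-count₃ {q} a b c G ext =
  trans (∑W-adj-split (w3 a b c) G ext)
   (cong (_+_ along₁) (trans (∑W-adj-split (w2 b c) _ (extensional-∷ ext a))
    (cong (_+_ along₂) (trans (∑W-adj-split (c ∷ []) _ (extensional-∷ (extensional-∷ ext a) b))
     (+-identityʳ _)))))
  where
  along₁ along₂ : ℕ
  along₁ = card (λ a′ → not (does (a ≟ a′)) ∧ G (w3 a′ b c))
  along₂ = card (λ b′ → not (does (b ≟ b′)) ∧ G (w3 a b′ c))

module _ {q} (X Y : SubA q) (h : Fin q → Fin q → Bool) {r c : ℕ}
  (h⊆X×Y : ∀ u v → h u v ≡ true → X u ≡ true × Y v ≡ true)
  (row-degree : ∀ u → X u ≡ true → card (λ v → h u v ∧ Y v) ≡ r)
  (column-degree : ∀ v → Y v ≡ true → card (λ u → h u v ∧ X u) ≡ c)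
  {u₀ v₀ : Fin q} (h₀ : h u₀ v₀ ≡ true) where

  private
    D V : Word 2 q → Bool
    D w = h (w zero) (w (suc zero))
    V = box2 X Y

    row-outside column-outside : Fin q → ℕ
    row-outside u = card (λ v → Y v ∧ not (h u v))
    column-outside v = card (λ u → X u ∧ not (h u v))

    outside : Fin q → Fin q → Bool
    outside u v = (X u ∧ Y v) ∧ not (h u v)

    A B : ℕ
    A = column-outside v₀
    B = row-outside u₀

    X-u₀ = proj₁ (h⊆X×Y u₀ v₀ h₀)
    Y-v₀ = proj₂ (h⊆X×Y u₀ v₀ h₀)

    column-outside+c : ∀ v → Y v ≡ true → column-outside v + c ≡ card X
    column-outside+c v Y-v =
      trans (cong (_+_ (column-outside v)) (sym (column-degree v Y-v))) (card-split X (λ u → h u v))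

    row-outside+r : ∀ u → X u ≡ true → row-outside u + r ≡ card Y
    row-outside+r u X-u =
      trans (cong (_+_ (row-outside u)) (sym (row-degree u X-u))) (card-split Y (h u))

    column-outside≡A : ∀ v → Y v ≡ true → column-outside v ≡ A
    column-outside≡A v Y-v = +-cancelʳ-≡ c _ _ (trans (column-outside+c v Y-v) (sym (column-outside+c v₀ Y-v₀)))

    row-outside≡B : ∀ u → X u ≡ true → row-outside u ≡ B
    row-outside≡B u X-u = +-cancelʳ-≡ r _ _ (trans (row-outside+r u X-u) (sym (row-outside+r u₀ X-u₀)))

    outer-degree : ∀ w → V w ≡ true → D w ≡ true → nOut V D w ≡ A + B
    outer-degree w Vw Dw = begin
      nOut V D w
        ≡⟨ adj-count₂ w _ (coordinates₂-extensional λ a b → (X a ∧ Y b) ∧ not (h a b)) ⟩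
      card (λ u′ → not (does (u ≟ u′)) ∧ ((X u′ ∧ Y v) ∧ not (h u′ v)))
        + card (λ v′ → not (does (v ≟ v′)) ∧ ((X u ∧ Y v′) ∧ not (h u v′)))
        ≡⟨ cong₂ _+_ (trans (card-except u excluded) (card-cong in-column))
                     (trans (card-except v excluded) (card-cong in-row)) ⟩
      column-outside v + row-outside u
        ≡⟨ cong₂ _+_ (column-outside≡A v Y-v) (row-outside≡B u X-u) ⟩
      A + B ∎
      where
      open ≡-Reasoning
      u = w zero
      v = w (suc zero)
      X-u = proj₁ (∧-true Vw)
      Y-v = proj₂ (∧-true Vw)
      excluded : (X u ∧ Y v) ∧ not (h u v) ≡ false
      excluded = trans (cong (λ t → (X u ∧ Y v) ∧ not t) Dw) (∧-zeroʳ _)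
      in-column : ∀ u′ → (X u′ ∧ Y v) ∧ not (h u′ v) ≡ X u′ ∧ not (h u′ v)
      in-column u′ = cong (_∧ not (h u′ v)) (trans (cong (X u′ ∧_) Y-v) (∧-identityʳ (X u′)))
      in-row : ∀ v′ → (X u ∧ Y v′) ∧ not (h u v′) ≡ Y v′ ∧ not (h u v′)
      in-row v′ = cong (λ t → (t ∧ Y v′) ∧ not (h u v′)) X-u

    inner-degree : ∀ w → V w ≡ true → D w ≡ false → nIn V D w ≡ c + r
    inner-degree w Vw ¬Dw = begin
      nIn V D w
        ≡⟨ adj-count₂ w _ (coordinates₂-extensional λ a b → (X a ∧ Y b) ∧ h a b) ⟩
      card (λ u′ → not (does (u ≟ u′)) ∧ ((X u′ ∧ Y v) ∧ h u′ v))
        + card (λ v′ → not (does (v ≟ v′)) ∧ ((X u ∧ Y v′) ∧ h u v′))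
        ≡⟨ cong₂ _+_ (trans (card-except u excluded) (card-cong in-column))
                     (trans (card-except v excluded) (card-cong in-row)) ⟩
      card (λ u′ → h u′ v ∧ X u′) + card (λ v′ → h u v′ ∧ Y v′)
        ≡⟨ cong₂ _+_ (column-degree v Y-v) (row-degree u X-u) ⟩
      c + r ∎
      where
      open ≡-Reasoning
      u = w zero
      v = w (suc zero)
      X-u = proj₁ (∧-true Vw)
      Y-v = proj₂ (∧-true Vw)
      excluded : (X u ∧ Y v) ∧ h u v ≡ false
      excluded = trans (cong ((X u ∧ Y v) ∧_) ¬Dw) (∧-zeroʳ _)
      in-column : ∀ u′ → (X u′ ∧ Y v) ∧ h u′ v ≡ h u′ v ∧ X u′
      in-column u′ = trans (cong (_∧ h u′ v) (trans (cong (X u′ ∧_) Y-v) (∧-identityʳ (X u′)))) (∧-comm (X u′) _)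
      in-row : ∀ v′ → (X u ∧ Y v′) ∧ h u v′ ≡ h u v′ ∧ Y v′
      in-row v′ = trans (cong (λ t → (t ∧ Y v′) ∧ h u v′) X-u) (∧-comm (Y v′) _)

  full⊎completelyRegular :
    (∀ w → h (w zero) (w (suc zero)) ≡ box2 X Y w)
    ⊎ IsCRC1Eigen (box2 X Y) (λ w → h (w zero) (w (suc zero))) (+ (card X + card Y) - + 2) (- + 2)
  full⊎completelyRegular with anyF (λ u → anyF (outside u)) in missing
  ... | false = inj₁ λ w → h≡X×Y (w zero) (w (suc zero))
    where
    h≡X×Y : ∀ u v → h u v ≡ X u ∧ Y v
    h≡X×Y u v with h u v in huv | X u ∧ Y v in XY
    ... | true  | _     = let X-u , Y-v = h⊆X×Y u v huv in trans (sym (cong₂ _∧_ X-u Y-v)) XY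
    ... | false | false = refl
    ... | false | true
      with trans (sym missing)
                 (anyF-intro (λ u → anyF (outside u)) (anyF-intro (outside u) (cong₂ (λ s t → s ∧ not t) XY huv)))
    ... | ()
  ... | true = inj₂ (A + B , c + r
                    , (D⊆V , (w2 u₀ v₀ , h₀) , (w2 u₁ v₁ , XY₁ , ¬h₁) , 1≤A+B , 1≤c+r , outer-degree , inner-degree)
                    , eigenvalue)
    where
    u₁ = proj₁ (anyF-elim (λ u → anyF (outside u)) missing)
    v₁-found = anyF-elim (outside u₁) (proj₂ (anyF-elim (λ u → anyF (outside u)) missing))
    v₁ = proj₁ v₁-found
    XY₁ = proj₁ (∧-true (proj₂ v₁-found))
    ¬h₁ : h u₁ v₁ ≡ false
    ¬h₁ = not-true (proj₂ (∧-true (proj₂ v₁-found)))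
    D⊆V : ∀ w → D w ≡ true → V w ≡ true
    D⊆V w Dw = let X-u , Y-v = h⊆X×Y _ _ Dw in cong₂ _∧_ X-u Y-v
    1≤A+B : 1 ≤ A + B
    1≤A+B = ≤-trans (subst (1 ≤_) (column-outside≡A v₁ (proj₂ (∧-true XY₁)))
                      (card-pos (λ u → X u ∧ not (h u v₁)) (cong₂ (λ s t → s ∧ not t) (proj₁ (∧-true XY₁)) ¬h₁)))
                    (m≤m+n A B)
    1≤c+r : 1 ≤ c + r
    1≤c+r = ≤-trans (subst (1 ≤_) (column-degree v₀ Y-v₀) (card-pos (λ u → h u v₀ ∧ X u) (cong₂ _∧_ h₀ X-u₀)))
                    (m≤m+n c r)
    degrees : A + B + (c + r) ≡ card X + card Y
    degrees = trans (interchange A B c r) (cong₂ _+_ (column-outside+c v₀ Y-v₀) (row-outside+r u₀ X-u₀))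
    eigenvalue : + (card X + card Y) - + 2 - + (A + B + (c + r)) ≡ - + 2
    eigenvalue rewrite degrees = xyx⁻¹≈y (+ (card X + card Y)) (- + 2)

unionOfCliques-respects : ∀ {q i} {C : Word 3 q → Bool} → NonemptyUnionOfCliques i C →
  ∀ {x y} → (∀ j → j ≢ i → x j ≡ y j) → C x ≡ C y
unionOfCliques-respects {C = C} (_ , _ , cliques) x≈y =
  ⇔⇒≡ (transfer x≈y) (transfer (λ j j≢i → sym (x≈y j j≢i)))
  where
  transfer : ∀ {x y} → (∀ j → j ≢ _ → x j ≡ y j) → C x ≡ true → C y ≡ true
  transfer {x} {y} x≈y Cx =
    let c , Fc , x∈c = proj₁ (cliques x) Cx in
    proj₂ (cliques y) (c , Fc , λ j j≢i → trans (sym (x≈y j j≢i)) (x∈c j j≢i))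
  ⇔⇒≡ : ∀ {a b} → (a ≡ true → b ≡ true) → (b ≡ true → a ≡ true) → a ≡ b
  ⇔⇒≡ {false} {false} _ _  = refl
  ⇔⇒≡ {false} {true}  _ b⇒a = b⇒a refl
  ⇔⇒≡ {true}          a⇒b _ = sym (a⇒b refl)

module ThreeFamilies {q : ℕ} (C₁ C₂ C₃ : Word 3 (suc q) → Bool)
  (U₁ : NonemptyUnionOfCliques p₁ C₁) (U₂ : NonemptyUnionOfCliques p₂ C₂)
  (U₃ : NonemptyUnionOfCliques p₃ C₃)
  (C₁∩C₂ : ∀ x → C₁ x ∧ C₂ x ≡ false) (C₁∩C₃ : ∀ x → C₁ x ∧ C₃ x ≡ false)
  (C₂∩C₃ : ∀ x → C₂ x ∧ C₃ x ≡ false)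
  {β : ℕ}
  (outer-degree : ∀ x → C₁ x ∨ C₂ x ∨ C₃ x ≡ true → nOut (λ _ → true) (λ x → C₁ x ∨ C₂ x ∨ C₃ x) x ≡ β)
  (S T R : SubA (suc q))
  (C₁⊆S×T : ⊆Box C₁ full S T)
  (S×T-minimal : ∀ S′ T′ → S′ ⊆A S → T′ ⊆A T → ⊆Box C₁ full S′ T′ → S ⊆A S′ × T ⊆A T′)
  (C₂⊆R : ∃ λ T′ → ⊆Box C₂ R full T′)
  (R-minimal : ∀ R′ → R′ ⊆A R → (∃ λ T′ → ⊆Box C₂ R′ full T′) → R ⊆A R′) where

  𝒜 : Set
  𝒜 = Fin (suc q)

  C : Word 3 (suc q) → Bool
  C x = C₁ x ∨ C₂ x ∨ C₃ x

  D₁ D₂ D₃ : 𝒜 → 𝒜 → Bool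
  D₁ b c = anyF (λ a → C₁ (w3 a b c))
  D₂ a c = anyF (λ b → C₂ (w3 a b c))
  D₃ a b = anyF (λ c → C₃ (w3 a b c))

  C₁≡D₁ : ∀ x → C₁ x ≡ D₁ (x p₂) (x p₃)
  C₁≡D₁ x = sym (anyF-const (λ a → C₁ (w3 a (x p₂) (x p₃))) λ a → unionOfCliques-respects U₁ λ
    { zero j≢i → ⊥-elim (j≢i refl) ; (suc zero) _ → refl ; (suc (suc zero)) _ → refl })

  C₂≡D₂ : ∀ x → C₂ x ≡ D₂ (x p₁) (x p₃)
  C₂≡D₂ x = sym (anyF-const (λ b → C₂ (w3 (x p₁) b (x p₃))) λ b → unionOfCliques-respects U₂ λ
    { zero _ → refl ; (suc zero) j≢i → ⊥-elim (j≢i refl) ; (suc (suc zero)) _ → refl })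

  C₃≡D₃ : ∀ x → C₃ x ≡ D₃ (x p₁) (x p₂)
  C₃≡D₃ x = sym (anyF-const (λ c → C₃ (w3 (x p₁) (x p₂) c)) λ c → unionOfCliques-respects U₃ λ
    { zero _ → refl ; (suc zero) _ → refl ; (suc (suc zero)) j≢i → ⊥-elim (j≢i refl) })

  C≡D : ∀ a b c → C (w3 a b c) ≡ D₁ b c ∨ D₂ a c ∨ D₃ a b
  C≡D a b c = cong₂ _∨_ (C₁≡D₁ (w3 a b c)) (cong₂ _∨_ (C₂≡D₂ (w3 a b c)) (C₃≡D₃ (w3 a b c)))

  C-extensional : Extensional (λ x → not (C x))
  C-extensional x≗y = cong not (cong₂ _∨_ (respects U₁) (cong₂ _∨_ (respects U₂) (respects U₃)))
    where
    respects : ∀ {i} {Cᵢ : Word 3 (suc q) → Bool} → NonemptyUnionOfCliques i Cᵢ → Cᵢ _ ≡ Cᵢ _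
    respects Uᵢ = unionOfCliques-respects Uᵢ (λ j _ → x≗y j)

  D₁∩D₂ : ∀ a b c → D₁ b c ∧ D₂ a c ≡ false
  D₁∩D₂ a b c = trans (sym (cong₂ _∧_ (C₁≡D₁ (w3 a b c)) (C₂≡D₂ (w3 a b c)))) (C₁∩C₂ (w3 a b c))

  D₁∩D₃ : ∀ a b c → D₁ b c ∧ D₃ a b ≡ false
  D₁∩D₃ a b c = trans (sym (cong₂ _∧_ (C₁≡D₁ (w3 a b c)) (C₃≡D₃ (w3 a b c)))) (C₁∩C₃ (w3 a b c))

  D₂∩D₃ : ∀ a b c → D₂ a c ∧ D₃ a b ≡ false
  D₂∩D₃ a b c = trans (sym (cong₂ _∧_ (C₂≡D₂ (w3 a b c)) (C₃≡D₃ (w3 a b c)))) (C₂∩C₃ (w3 a b c))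

  D₁⊆S×T : ∀ {b c} → D₁ b c ≡ true → S b ≡ true × T c ≡ true
  D₁⊆S×T {b} {c} D₁bc =
    let a , C₁abc = anyF-elim (λ a → C₁ (w3 a b c)) D₁bc in proj₂ (C₁⊆S×T (w3 a b c) C₁abc)

  D₂⊆R : ∀ {a c} → D₂ a c ≡ true → R a ≡ true
  D₂⊆R {a} {c} D₂ac =
    let b , C₂abc = anyF-elim (λ b → C₂ (w3 a b c)) D₂ac in proj₁ (proj₂ C₂⊆R (w3 a b c) C₂abc)

  S⊆dom-D₁ : ∀ {b} → S b ≡ true → ∃ λ c → D₁ b c ≡ true
  S⊆dom-D₁ {b} Sb =
    anyF-elim (D₁ b) (proj₂ (∧-true (proj₁ (S×T-minimal S′ T (λ _ → proj₁ ∘ ∧-true) (λ _ → id) box) b Sb)))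
    where
    S′ : SubA (suc q)
    S′ b = S b ∧ anyF (D₁ b)
    box : ⊆Box C₁ full S′ T
    box x C₁x = let D₁x = trans (sym (C₁≡D₁ x)) C₁x ; S-b , T-c = D₁⊆S×T D₁x in
      refl , cong₂ _∧_ S-b (anyF-intro (D₁ (x p₂)) D₁x) , T-c

  T⊆ran-D₁ : ∀ {c} → T c ≡ true → ∃ λ b → D₁ b c ≡ true
  T⊆ran-D₁ {c} Tc =
    anyF-elim (λ b → D₁ b c) (proj₂ (∧-true (proj₂ (S×T-minimal S T′ (λ _ → id) (λ _ → proj₁ ∘ ∧-true) box) c Tc)))
    where
    T′ : SubA (suc q)
    T′ c = T c ∧ anyF (λ b → D₁ b c)
    box : ⊆Box C₁ full S T′
    box x C₁x = let D₁x = trans (sym (C₁≡D₁ x)) C₁x ; S-b , T-c = D₁⊆S×T D₁x in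
      refl , S-b , cong₂ _∧_ T-c (anyF-intro (λ b → D₁ b (x p₃)) D₁x)

  R⊆dom-D₂ : ∀ {a} → R a ≡ true → ∃ λ c → D₂ a c ≡ true
  R⊆dom-D₂ {a} Ra = anyF-elim (D₂ a) (proj₂ (∧-true (R-minimal R′ (λ _ → proj₁ ∘ ∧-true) (full , box) a Ra)))
    where
    R′ : SubA (suc q)
    R′ a = R a ∧ anyF (D₂ a)
    box : ⊆Box C₂ R′ full full
    box x C₂x = let D₂x = trans (sym (C₂≡D₂ x)) C₂x in
      cong₂ _∧_ (D₂⊆R D₂x) (anyF-intro (D₂ (x p₁)) D₂x) , refl , refl

  D₂⊆∁T : ∀ {a c} → D₂ a c ≡ true → ∁ T c ≡ true
  D₂⊆∁T {a} {c} D₂ac =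
    cong not (exclusive-sym (λ Tc → let b , D₁bc = T⊆ran-D₁ Tc in exclusive (D₁∩D₂ a b c) D₁bc) D₂ac)

  D₃⊆∁S : ∀ {a b} → D₃ a b ≡ true → ∁ S b ≡ true
  D₃⊆∁S {a} {b} D₃ab =
    cong not (exclusive-sym (λ Sb → let c , D₁bc = S⊆dom-D₁ Sb in exclusive (D₁∩D₃ a b c) D₁bc) D₃ab)

  D₃⊆∁R : ∀ {a b} → D₃ a b ≡ true → ∁ R a ≡ true
  D₃⊆∁R {a} {b} D₃ab =
    cong not (exclusive-sym (λ Ra → let c , D₂ac = R⊆dom-D₂ Ra in exclusive (D₂∩D₃ a b c) D₂ac) D₃ab)

  -- plane₁ a is the number of cliques of C³ and of C² lying in the plane x₁ = a; similarly plane₂, plane₃.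
  plane₁ plane₂ plane₃ : 𝒜 → ℕ
  plane₁ a = card (D₃ a) + card (D₂ a)
  plane₂ b = card (λ a → D₃ a b) + card (D₁ b)
  plane₃ c = card (λ a → D₂ a c) + card (λ b → D₁ b c)

  outside₁ outside₂ outside₃ : 𝒜 → 𝒜 → 𝒜 → ℕ
  outside₁ a b c = card (λ a′ → not (does (a ≟ a′)) ∧ not (C (w3 a′ b c)))
  outside₂ a b c = card (λ b′ → not (does (b ≟ b′)) ∧ not (C (w3 a b′ c)))
  outside₃ a b c = card (λ c′ → not (does (c ≟ c′)) ∧ not (C (w3 a b c′)))

  β≡outside : ∀ a b c → C (w3 a b c) ≡ true → β ≡ outside₁ a b c + (outside₂ a b c + outside₃ a b c)
  β≡outside a b c Cx = trans (sym (outer-degree (w3 a b c) Cx)) (adj-count₃ a b c _ C-extensional)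

  β+plane₁ : ∀ a {b c} → D₁ b c ≡ true →
    β + plane₁ a ≡ card (λ b′ → not (D₁ b′ c)) + card (λ c′ → not (D₁ b c′))
  β+plane₁ a {b} {c} D₁bc = begin
    β + plane₁ a
      ≡⟨ cong (λ n → n + plane₁ a) (β≡outside a b c (C-on-line a)) ⟩
    (outside₁ a b c + (outside₂ a b c + outside₃ a b c)) + (card (D₃ a) + card (D₂ a))
      ≡⟨ cong (λ n → n + (outside₂ a b c + outside₃ a b c) + plane₁ a) (line-inside a _ C-on-line) ⟩
    (outside₂ a b c + outside₃ a b c) + (card (D₃ a) + card (D₂ a))
      ≡⟨ interchange (outside₂ a b c) _ _ _ ⟩
    (outside₂ a b c + card (D₃ a)) + (outside₃ a b c + card (D₂ a))
      ≡⟨ cong₂ _+_ (card-line b _ (λ b′ → D₁ b′ c) (D₃ a) line₂ D₁bc (λ b′ → exclusive-sym (exclusive (D₁∩D₃ a b′ c))))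
                   (card-line c _ (D₁ b) (D₂ a) line₃ D₁bc (λ c′ → exclusive-sym (exclusive (D₁∩D₂ a b c′)))) ⟩
    card (λ b′ → not (D₁ b′ c)) + card (λ c′ → not (D₁ b c′)) ∎
    where
    open ≡-Reasoning
    C-on-line : ∀ a′ → C (w3 a′ b c) ≡ true
    C-on-line a′ = trans (C≡D a′ b c) (cong (_∨ (D₂ a′ c ∨ D₃ a′ b)) D₁bc)
    line₂ : ∀ b′ → C (w3 a b′ c) ≡ D₁ b′ c ∨ D₃ a b′
    line₂ b′ = trans (C≡D a b′ c) (cong (λ t → D₁ b′ c ∨ t ∨ D₃ a b′) (exclusive (D₁∩D₂ a b c) D₁bc))
    line₃ : ∀ c′ → C (w3 a b c′) ≡ D₁ b c′ ∨ D₂ a c′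
    line₃ c′ = trans (C≡D a b c′) (trans (cong (λ t → D₁ b c′ ∨ D₂ a c′ ∨ t) (exclusive (D₁∩D₃ a b c) D₁bc))
                                       (cong (D₁ b c′ ∨_) (∨-identityʳ _)))

  β+plane₂ : ∀ b {a c} → D₂ a c ≡ true →
    β + plane₂ b ≡ card (λ a′ → not (D₂ a′ c)) + card (λ c′ → not (D₂ a c′))
  β+plane₂ b {a} {c} D₂ac = begin
    β + plane₂ b
      ≡⟨ cong (λ n → n + plane₂ b) (β≡outside a b c (C-on-line b)) ⟩
    (outside₁ a b c + (outside₂ a b c + outside₃ a b c)) + plane₂ b
      ≡⟨ cong (λ n → (outside₁ a b c + (n + outside₃ a b c)) + plane₂ b) (line-inside b _ C-on-line) ⟩
    (outside₁ a b c + outside₃ a b c) + (card (λ a′ → D₃ a′ b) + card (D₁ b))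
      ≡⟨ interchange (outside₁ a b c) _ _ _ ⟩
    (outside₁ a b c + card (λ a′ → D₃ a′ b)) + (outside₃ a b c + card (D₁ b))
      ≡⟨ cong₂ _+_ (card-line a _ (λ a′ → D₂ a′ c) (λ a′ → D₃ a′ b) line₁ D₂ac
                              (λ a′ → exclusive-sym (exclusive (D₂∩D₃ a′ b c))))
                   (card-line c _ (D₂ a) (D₁ b) line₃ D₂ac (λ c′ → exclusive (D₁∩D₂ a b c′))) ⟩
    card (λ a′ → not (D₂ a′ c)) + card (λ c′ → not (D₂ a c′)) ∎
    where
    open ≡-Reasoning
    C-on-line : ∀ b′ → C (w3 a b′ c) ≡ true
    C-on-line b′ = trans (C≡D a b′ c) (trans (cong (λ t → D₁ b′ c ∨ t ∨ D₃ a b′) D₂ac) (∨-zeroʳ _))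
    line₁ : ∀ a′ → C (w3 a′ b c) ≡ D₂ a′ c ∨ D₃ a′ b
    line₁ a′ = trans (C≡D a′ b c) (cong (_∨ (D₂ a′ c ∨ D₃ a′ b)) (exclusive-sym (exclusive (D₁∩D₂ a b c)) D₂ac))
    line₃ : ∀ c′ → C (w3 a b c′) ≡ D₂ a c′ ∨ D₁ b c′
    line₃ c′ = trans (C≡D a b c′) (trans (cong (λ t → D₁ b c′ ∨ D₂ a c′ ∨ t) (exclusive (D₂∩D₃ a b c) D₂ac))
                                  (trans (cong (D₁ b c′ ∨_) (∨-identityʳ _)) (∨-comm (D₁ b c′) _)))

  β+plane₃ : ∀ c {a b} → D₃ a b ≡ true →
    β + plane₃ c ≡ card (λ a′ → not (D₃ a′ b)) + card (λ b′ → not (D₃ a b′))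
  β+plane₃ c {a} {b} D₃ab = begin
    β + plane₃ c
      ≡⟨ cong (λ n → n + plane₃ c) (β≡outside a b c (C-on-line c)) ⟩
    (outside₁ a b c + (outside₂ a b c + outside₃ a b c)) + plane₃ c
      ≡⟨ cong (λ n → (outside₁ a b c + (outside₂ a b c + n)) + plane₃ c) (line-inside c _ C-on-line) ⟩
    (outside₁ a b c + (outside₂ a b c + 0)) + plane₃ c
      ≡⟨ cong (λ n → (outside₁ a b c + n) + plane₃ c) (+-identityʳ _) ⟩
    (outside₁ a b c + outside₂ a b c) + (card (λ a′ → D₂ a′ c) + card (λ b′ → D₁ b′ c))
      ≡⟨ interchange (outside₁ a b c) _ _ _ ⟩
    (outside₁ a b c + card (λ a′ → D₂ a′ c)) + (outside₂ a b c + card (λ b′ → D₁ b′ c))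
      ≡⟨ cong₂ _+_ (card-line a _ (λ a′ → D₃ a′ b) (λ a′ → D₂ a′ c) line₁ D₃ab (λ a′ → exclusive (D₂∩D₃ a′ b c)))
                   (card-line b _ (D₃ a) (λ b′ → D₁ b′ c) line₂ D₃ab (λ b′ → exclusive (D₁∩D₃ a b′ c))) ⟩
    card (λ a′ → not (D₃ a′ b)) + card (λ b′ → not (D₃ a b′)) ∎
    where
    open ≡-Reasoning
    C-on-line : ∀ c′ → C (w3 a b c′) ≡ true
    C-on-line c′ = trans (C≡D a b c′) (trans (cong (λ t → D₁ b c′ ∨ D₂ a c′ ∨ t) D₃ab)
                                     (trans (cong (D₁ b c′ ∨_) (∨-zeroʳ _)) (∨-zeroʳ _)))
    line₁ : ∀ a′ → C (w3 a′ b c) ≡ D₃ a′ b ∨ D₂ a′ c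
    line₁ a′ = trans (C≡D a′ b c)
                     (trans (cong (_∨ (D₂ a′ c ∨ D₃ a′ b)) (exclusive-sym (exclusive (D₁∩D₃ a b c)) D₃ab))
                                  (∨-comm (D₂ a′ c) _))
    line₂ : ∀ b′ → C (w3 a b′ c) ≡ D₃ a b′ ∨ D₁ b′ c
    line₂ b′ = trans (C≡D a b′ c)
                     (trans (cong (λ t → D₁ b′ c ∨ t ∨ D₃ a b′) (exclusive-sym (exclusive (D₂∩D₃ a b c)) D₃ab))
                                  (∨-comm (D₁ b′ c) _))

  D₁-nonempty : ∃ λ b → ∃ λ c → D₁ b c ≡ true
  D₁-nonempty = let x , C₁x = proj₁ U₁ in x p₂ , x p₃ , trans (sym (C₁≡D₁ x)) C₁x

  D₂-nonempty : ∃ λ a → ∃ λ c → D₂ a c ≡ true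
  D₂-nonempty = let x , C₂x = proj₁ U₂ in x p₁ , x p₃ , trans (sym (C₂≡D₂ x)) C₂x

  D₃-nonempty : ∃ λ a → ∃ λ b → D₃ a b ≡ true
  D₃-nonempty = let x , C₃x = proj₁ U₃ in x p₁ , x p₂ , trans (sym (C₃≡D₃ x)) C₃x

  plane₁-constant : ∀ a → plane₁ a ≡ plane₁ zero
  plane₁-constant a = let _ , _ , D₁bc = D₁-nonempty in
    +-cancelˡ-≡ β _ _ (trans (β+plane₁ a D₁bc) (sym (β+plane₁ zero D₁bc)))

  plane₂-constant : ∀ b → plane₂ b ≡ plane₂ zero
  plane₂-constant b = let _ , _ , D₂ac = D₂-nonempty in
    +-cancelˡ-≡ β _ _ (trans (β+plane₂ b D₂ac) (sym (β+plane₂ zero D₂ac)))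

  plane₃-constant : ∀ c → plane₃ c ≡ plane₃ zero
  plane₃-constant c = let _ , _ , D₃ab = D₃-nonempty in
    +-cancelˡ-≡ β _ _ (trans (β+plane₃ c D₃ab) (sym (β+plane₃ zero D₃ab)))

  D₁-column : ∀ v → T v ≡ true → card (λ u → D₁ u v ∧ S u) ≡ plane₃ zero
  D₁-column v Tv = begin
    card (λ u → D₁ u v ∧ S u)
      ≡⟨ card-restrict (λ u → D₁ u v) S (λ u → proj₁ ∘ D₁⊆S×T {u} {v}) ⟩
    card (λ u → D₁ u v)
      ≡⟨ cong (_+ card (λ u → D₁ u v)) (sym (card-≡0 λ a → contraposition (D₂⊆∁T {a} {v}) (cong not Tv))) ⟩
    plane₃ v
      ≡⟨ plane₃-constant v ⟩
    plane₃ zero ∎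
    where open ≡-Reasoning

  D₂-column : ∀ v → ∁ T v ≡ true → card (λ u → D₂ u v ∧ R u) ≡ plane₃ zero
  D₂-column v ¬Tv = begin
    card (λ u → D₂ u v ∧ R u)
      ≡⟨ card-restrict (λ u → D₂ u v) R (λ u → D₂⊆R {u} {v}) ⟩
    card (λ u → D₂ u v)
      ≡⟨ sym (+-identityʳ _) ⟩
    card (λ u → D₂ u v) + 0
      ≡⟨ cong (_+_ (card (λ u → D₂ u v)))
              (sym (card-≡0 λ b → contraposition (proj₂ ∘ D₁⊆S×T {b} {v}) (not-true ¬Tv))) ⟩
    plane₃ v
      ≡⟨ plane₃-constant v ⟩
    plane₃ zero ∎
    where open ≡-Reasoning

  D₁-row : ∀ u → S u ≡ true → card (λ v → D₁ u v ∧ T v) ≡ plane₂ zero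
  D₁-row u Su = begin
    card (λ v → D₁ u v ∧ T v)
      ≡⟨ card-restrict (D₁ u) T (λ v → proj₂ ∘ D₁⊆S×T {u} {v}) ⟩
    card (D₁ u)
      ≡⟨ cong (_+ card (D₁ u)) (sym (card-≡0 λ a → contraposition (D₃⊆∁S {a} {u}) (cong not Su))) ⟩
    plane₂ u
      ≡⟨ plane₂-constant u ⟩
    plane₂ zero ∎
    where open ≡-Reasoning

  D₃-column : ∀ v → ∁ S v ≡ true → card (λ u → D₃ u v ∧ ∁ R u) ≡ plane₂ zero
  D₃-column v ¬Sv = begin
    card (λ u → D₃ u v ∧ ∁ R u)
      ≡⟨ card-restrict (λ u → D₃ u v) (∁ R) (λ u → D₃⊆∁R {u} {v}) ⟩
    card (λ u → D₃ u v)
      ≡⟨ sym (+-identityʳ _) ⟩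
    card (λ u → D₃ u v) + 0
      ≡⟨ cong (_+_ (card (λ u → D₃ u v)))
              (sym (card-≡0 λ c → contraposition (proj₁ ∘ D₁⊆S×T {v} {c}) (not-true ¬Sv))) ⟩
    plane₂ v
      ≡⟨ plane₂-constant v ⟩
    plane₂ zero ∎
    where open ≡-Reasoning

  D₂-row : ∀ u → R u ≡ true → card (λ v → D₂ u v ∧ ∁ T v) ≡ plane₁ zero
  D₂-row u Ru = begin
    card (λ v → D₂ u v ∧ ∁ T v)
      ≡⟨ card-restrict (D₂ u) (∁ T) (λ v → D₂⊆∁T {u} {v}) ⟩
    card (D₂ u)
      ≡⟨ cong (_+ card (D₂ u)) (sym (card-≡0 λ b → contraposition (D₃⊆∁R {u} {b}) (cong not Ru))) ⟩
    plane₁ u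
      ≡⟨ plane₁-constant u ⟩
    plane₁ zero ∎
    where open ≡-Reasoning

  D₃-row : ∀ u → ∁ R u ≡ true → card (λ v → D₃ u v ∧ ∁ S v) ≡ plane₁ zero
  D₃-row u ¬Ru = begin
    card (λ v → D₃ u v ∧ ∁ S v)
      ≡⟨ card-restrict (D₃ u) (∁ S) (λ v → D₃⊆∁S {u} {v}) ⟩
    card (D₃ u)
      ≡⟨ sym (+-identityʳ _) ⟩
    card (D₃ u) + 0
      ≡⟨ cong (_+_ (card (D₃ u))) (sym (card-≡0 λ c → contraposition (D₂⊆R {u} {c}) (not-true ¬Ru))) ⟩
    plane₁ u
      ≡⟨ plane₁-constant u ⟩
    plane₁ zero ∎
    where open ≡-Reasoning

  plane₁-nonzero : plane₁ zero ≢ 0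
  plane₁-nonzero = let a , _ , D₂ac = D₂-nonempty in
    card≢0 (λ v → D₂ a v ∧ ∁ T v) (D₂-row a (D₂⊆R D₂ac)) (cong₂ _∧_ D₂ac (D₂⊆∁T D₂ac))

  plane₂-nonzero : plane₂ zero ≢ 0
  plane₂-nonzero = let b , _ , D₁bc = D₁-nonempty ; Sb , Tc = D₁⊆S×T D₁bc in
    card≢0 (λ v → D₁ b v ∧ T v) (D₁-row b Sb) (cong₂ _∧_ D₁bc Tc)

  plane₃-nonzero : plane₃ zero ≢ 0
  plane₃-nonzero = let _ , c , D₁bc = D₁-nonempty ; Sb , Tc = D₁⊆S×T D₁bc in
    card≢0 (λ u → D₁ u c ∧ S u) (D₁-column c Tc) (cong₂ _∧_ D₁bc Sb)

lemma3 : (q : ℕ) → 2 ≤ q →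
  (C₁ C₂ C₃ : Word 3 q → Bool) →
  NonemptyUnionOfCliques p₁ C₁ →
  NonemptyUnionOfCliques p₂ C₂ →
  NonemptyUnionOfCliques p₃ C₃ →
  (∀ x → C₁ x ∧ C₂ x ≡ false) →
  (∀ x → C₁ x ∧ C₃ x ≡ false) →
  (∀ x → C₂ x ∧ C₃ x ≡ false) →
  IsCRC1 (λ _ → true) (λ x → C₁ x ∨ C₂ x ∨ C₃ x) →
  (S T R : SubA q) →
  ⊆Box C₁ full S T →
  (∀ S′ T′ → S′ ⊆A S → T′ ⊆A T → ⊆Box C₁ full S′ T′ → S ⊆A S′ × T ⊆A T′) →
  (∃ λ T′ → ⊆Box C₂ R full T′) →
  (∀ R′ → R′ ⊆A R → (∃ λ T′ → ⊆Box C₂ R′ full T′) → R ⊆A R′) →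
  let D₁ = λ (w : Word 2 q) → anyF (λ a → C₁ (w3 a (w zero) (w (suc zero))))
      D₂ = λ (w : Word 2 q) → anyF (λ a → C₂ (w3 (w zero) a (w (suc zero))))
      D₃ = λ (w : Word 2 q) → anyF (λ a → C₃ (w3 (w zero) (w (suc zero)) a))
      V₁ = box2 S T
      V₂ = box2 R (∁ T)
      V₃ = box2 (∁ R) (∁ S)
      k = λ (X Y : SubA q) → + (card X + card Y) - + 2
  in ((∀ w → D₁ w ≡ V₁ w) ⊎ IsCRC1Eigen V₁ D₁ (k S T) (- + 2))
   × ((∀ w → D₂ w ≡ V₂ w) ⊎ IsCRC1Eigen V₂ D₂ (k R (∁ T)) (- + 2))
   × ((∀ w → D₃ w ≡ V₃ w) ⊎ IsCRC1Eigen V₃ D₃ (k (∁ R) (∁ S)) (- + 2))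
   × (∃ λ a → ∃ λ b → ∃ λ c → a ≢ 0 × b ≢ 0 × c ≢ 0
       × (∀ v → T v ≡ true → ∑ (λ u → [ D₁ (w2 u v) ∧ S u ]) ≡ a)
       × (∀ u → S u ≡ true → ∑ (λ v → [ D₁ (w2 u v) ∧ T v ]) ≡ b)
       × (∀ v → ∁ T v ≡ true → ∑ (λ u → [ D₂ (w2 u v) ∧ R u ]) ≡ a)
       × (∀ u → R u ≡ true → ∑ (λ v → [ D₂ (w2 u v) ∧ ∁ T v ]) ≡ c)
       × (∀ v → ∁ S v ≡ true → ∑ (λ u → [ D₃ (w2 u v) ∧ ∁ R u ]) ≡ b)
       × (∀ u → ∁ R u ≡ true → ∑ (λ v → [ D₃ (w2 u v) ∧ ∁ S v ]) ≡ c))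
lemma3 (suc q) _ C₁ C₂ C₃ U₁ U₂ U₃ C₁∩C₂ C₁∩C₃ C₂∩C₃ (_ , _ , _ , _ , _ , _ , _ , outer , _)
       S T R C₁⊆S×T S×T-minimal C₂⊆R R-minimal =
    full⊎completelyRegular S T D₁ (λ _ _ → D₁⊆S×T) D₁-row D₁-column (proj₂ (proj₂ D₁-nonempty))
  , full⊎completelyRegular R (∁ T) D₂ (λ _ _ D₂ac → D₂⊆R D₂ac , D₂⊆∁T D₂ac) D₂-row D₂-column
      (proj₂ (proj₂ D₂-nonempty))
  , full⊎completelyRegular (∁ R) (∁ S) D₃ (λ _ _ D₃ab → D₃⊆∁R D₃ab , D₃⊆∁S D₃ab) D₃-row D₃-column
      (proj₂ (proj₂ D₃-nonempty))
  , plane₃ zero , plane₂ zero , plane₁ zero , plane₃-nonzero , plane₂-nonzero , plane₁-nonzero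
  , D₁-column , D₁-row , D₂-column , D₂-row , D₃-column , D₃-row
  where
  open ThreeFamilies C₁ C₂ C₃ U₁ U₂ U₃ C₁∩C₂ C₁∩C₃ C₂∩C₃ (λ x → outer x refl)
                     S T R C₁⊆S×T S×T-minimal C₂⊆R R-minimal
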